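{- Let $\Gamma$ be a finite, simple, connected cubic graph and $G\leq\mathrm{Aut}(\Gamma)$ vertex-transitive such that $(\Gamma,G)$ is locally-$\mathbb Z_2^{[3]}$ and not degenerate. Let $\mathrm M(\Gamma,G)$ and $\mathcal C(\Gamma,G)$ be as defined below, and let $\Gamma'=\mathrm S(\mathrm M(\Gamma,G),\mathcal C(\Gamma,G))$. Then $\Gamma'\cong\Gamma$.
   Context: $(\Gamma,G)$ is locally-$\mathbb Z_2^{[3]}$ if for a vertex $v$ the group induced by $G_v$ on the neighbourhood $\Gamma(v)$ is permutation isomorphic to the group of order $2$ acting on $3$ points. Then each vertex $u$ has a unique neighbour $u'$ fixed by $G_u$; $\mathcal T=\{\{u,u'\}:u\in\mathrm V(\Gamma)\}$ is a $G$-edge-orbit forming a perfect matching, and the remaining edges form a $G$-edge-orbit $\mathcal R$ inducing a disjoint union of cycles $C_1,\dots,C_n$. The pair is degenerate if for some $\{u,u'\},\{v,v'\}\in\mathcal T$ there is more than one edge of $\Gamma$ between these two sets. $\mathrm M(\Gamma,G)$ has vertex-set $\mathcal T$, with $\{u,u'\}\sim\{v,v'\}$ iff some member of one is adjacent in $\Gamma$ to some member of the other; with $\iota(\{u,v\})=\{\{u,u'\},\{v,v'\}\}$ for $\{u,v\}\in\mathcal R$, set $\mathcal C(\Gamma,G)=\{\iota(C_1),\dots,\iota(C_n)\}$, a set of cycles of $\mathrm M(\Gamma,G)$. For a graph $\Lambda$ and a set $\mathcal C$ of cycles of $\Lambda$ decomposing its edges, $\mathrm S(\Lambda,\mathcal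 C)$ is the graph whose vertices are the pairs $(v,C)$ with $v\in\mathrm V(\Lambda)$, $C\in\mathcal C$ and $v$ on $C$, where $(v_1,C_1)\sim(v_2,C_2)$ iff either $C_1\neq C_2$ and $v_1=v_2$, or $C_1=C_2$ and $\{v_1,v_2\}$ is an edge of $C_1$. -}

module Defs where

open import Data.Nat using (ℕ)
open import Data.Fin using (Fin)
open import Data.Fin.Permutation using (Permutation′; _⟨$⟩ʳ_; id; flip; _∘ₚ_)
open import Data.Product using (Σ; ∃; ∃-syntax; _×_; _,_; proj₁; proj₂)
open import Data.Sum using (_⊎_)
open import Relation.Nullary using (¬_; Dec)
open import Relation.Binary.PropositionalEquality using (_≡_)
open import Relation.Binary.Construct.Closure.ReflexiveTransitive using (Star)
open import Function.Bundles using (_⇔_)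

record SimpleGraph (n : ℕ) : Set₁ where
  field
    Adj     : Fin n → Fin n → Set
    adj?    : ∀ u v → Dec (Adj u v)
    sym     : ∀ {u v} → Adj u v → Adj v u
    irrefl  : ∀ {u} → ¬ Adj u u

module _ {n : ℕ} (Γ : SimpleGraph n) where
  open SimpleGraph Γ

  Cubic : Set
  Cubic = ∀ v → ∃[ a ] ∃[ b ] ∃[ c ]
            (¬ a ≡ b × ¬ a ≡ c × ¬ b ≡ c
            × Adj v a × Adj v b × Adj v c
            × (∀ w → Adj v w → w ≡ a ⊎ w ≡ b ⊎ w ≡ c))

  Connected : Set
  Connected = ∀ u v → Star Adj u v

  IsAut : Permutation′ n → Set
  IsAut σ = ∀ u v → Adj u v ⇔ Adj (σ ⟨$⟩ʳ u) (σ ⟨$⟩ʳ v)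

record PermGroup (n : ℕ) : Set₁ where
  field
    InG     : Permutation′ n → Set
    id∈     : InG id
    ∘∈      : ∀ {g h} → InG g → InG h → InG (g ∘ₚ h)
    inv∈    : ∀ {g} → InG g → InG (flip g)

module _ {n : ℕ} (Γ : SimpleGraph n) (G : PermGroup n) where
  open SimpleGraph Γ
  open PermGroup G

  SubgroupOfAut : Set
  SubgroupOfAut = ∀ g → InG g → IsAut Γ g

  VertexTransitive : Set
  VertexTransitive = ∀ u v → ∃[ g ] (InG g × g ⟨$⟩ʳ u ≡ v)

  InStab : Fin n → Permutation′ n → Set
  InStab v g = InG g × g ⟨$⟩ʳ v ≡ v

  -- locally-Z₂^[3]: for a vertex v, the group induced by G_v on Γ(v) = {a,b,c}
  -- is the group of order 2 on 3 points, i.e. {id, (b c)}.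
  LocallyZ2-3 : Set
  LocallyZ2-3 = ∃[ v ] ∃[ a ] ∃[ b ] ∃[ c ]
      ( (¬ a ≡ b × ¬ a ≡ c × ¬ b ≡ c)
      × (Adj v a × Adj v b × Adj v c)
      × (∀ w → Adj v w → w ≡ a ⊎ w ≡ b ⊎ w ≡ c)
      × (∀ g → InStab v g →
           g ⟨$⟩ʳ a ≡ a
           × ((g ⟨$⟩ʳ b ≡ b × g ⟨$⟩ʳ c ≡ c) ⊎ (g ⟨$⟩ʳ b ≡ c × g ⟨$⟩ʳ c ≡ b)))
      × (∃[ g ] (InStab v g × g ⟨$⟩ʳ b ≡ c × g ⟨$⟩ʳ c ≡ b)) )

  Partner : Fin n → Fin n → Set
  Partner u w = Adj u w × (∀ g → InStab u g → g ⟨$⟩ʳ w ≡ w)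

  InPair : Fin n → Fin n → Set
  InPair u z = z ≡ u ⊎ Partner u z

  InT : Fin n → Fin n → Set
  InT a b = Partner a b ⊎ Partner b a

  InR : Fin n → Fin n → Set
  InR a b = Adj a b × ¬ InT a b

  Degenerate : Set
  Degenerate = ∃[ u ] ∃[ v ] ∃[ a ] ∃[ b ] ∃[ c ] ∃[ d ]
      ( InPair u a × InPair v b × Adj a b
      × InPair u c × InPair v d × Adj c d
      × ¬ (a ≡ c × b ≡ d) × ¬ (a ≡ d × b ≡ c) )

record Graph : Set₁ where
  field
    V    : Set
    _≈_  : V → V → Set
    _~_  : V → V → Set

record _≅_ (A B : Graph) : Set where
  private
    module A = Graph A
    module B = Graph B
  field
    to        : A.V → B.V
    from      : B.V → A.V
    to-cong   : ∀ {x y} → x A.≈ y → to x B.≈ to y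
    from-cong : ∀ {x y} → x B.≈ y → from x A.≈ from y
    to-from   : ∀ y → to (from y) B.≈ y
    from-to   : ∀ x → from (to x) A.≈ x
    adj       : ∀ x y → (x A.~ y) ⇔ (to x B.~ to y)

asGraph : ∀ {n} → SimpleGraph n → Graph
asGraph {n} Γ = record { V = Fin n ; _≈_ = _≡_ ; _~_ = SimpleGraph.Adj Γ }

record CycleSet (Λ : Graph) : Set₁ where
  open Graph Λ
  field
    Idx    : Set
    EdgeOf : Idx → V → V → Set

  SameCycle : Idx → Idx → Set
  SameCycle C D = ∀ x y → EdgeOf C x y ⇔ EdgeOf D x y

  OnCycle : V → Idx → Set
  OnCycle x C = ∃[ y ] EdgeOf C x y

S : (Λ : Graph) → CycleSet Λ → Graph
S Λ 𝒞 = record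
  { V   = Σ (V × Idx) (λ p → OnCycle (proj₁ p) (proj₂ p))
  ; _≈_ = λ p q → (proj₁ (proj₁ p) ≈ proj₁ (proj₁ q))
                  × SameCycle (proj₂ (proj₁ p)) (proj₂ (proj₁ q))
  ; _~_ = λ p q →
      (¬ SameCycle (proj₂ (proj₁ p)) (proj₂ (proj₁ q))
         × proj₁ (proj₁ p) ≈ proj₁ (proj₁ q))
      ⊎ (SameCycle (proj₂ (proj₁ p)) (proj₂ (proj₁ q))
         × EdgeOf (proj₂ (proj₁ p)) (proj₁ (proj₁ p)) (proj₁ (proj₁ q)))
  }
  where
    open Graph Λ
    open CycleSet 𝒞

module _ {n : ℕ} (Γ : SimpleGraph n) (G : PermGroup n) where
  open SimpleGraph Γ

  -- vertices of M(Γ,G) are the pairs {u,u'} ∈ 𝒯, represented by any member u;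
  -- two representatives are equal iff they give the same pair (as a set)
  SamePair : Fin n → Fin n → Set
  SamePair u v = ∀ z → InPair Γ G u z ⇔ InPair Γ G v z

  M : Graph
  M = record
    { V   = Fin n
    ; _≈_ = SamePair
    ; _~_ = λ u v → ¬ SamePair u v
                    × ∃[ a ] ∃[ b ] (InPair Γ G u a × InPair Γ G v b × Adj a b)
    }

  -- the cycles C_1,…,C_n induced by ℛ are the connected components of the
  -- graph (V(Γ), ℛ); the component C_r is represented by any vertex r on it.
  -- ι(C_r) has edge set { ι({a,b}) : {a,b} ∈ ℛ, a ∈ C_r }.
  𝒞 : CycleSet M
  𝒞 = record
    { Idx    = Fin n
    ; EdgeOf = λ r x y → ∃[ a ] ∃[ b ]
        (Star (InR Γ G) r a × InR Γ G a b × InPair Γ G x a × InPair Γ G y b)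
    }

module Submission where

-- Transport the local data at one vertex v₀ along a vertex-transitive
-- G.  This gives the partner map u ↦ u′ (the unique neighbour fixed by G_u);
-- it is G-equivariant and, by a pigeonhole argument on stabilisers,
-- an involution.  The remaining edges ℛ are those {x,y} with y ≠ x′, and every
-- vertex has exactly two ℛ-neighbours, interchanged by an element of G_x.
-- Hence at each x there is a "rotation" ρ ∈ G moving x one step along its
-- ℛ-cycle, and every vertex reachable from x along ℛ is g · x for some g ∈ G
-- commuting with ρ.  If x′ were reachable, such a g would map the ℛ-edge
-- {x, ρx} to an edge {x′, (ρx)′}: two edges between the same two members of 𝒯,
-- which non-degeneracy forbids.  So each ℛ-cycle meets each pair {x,x′} at most
-- once, and the vertex (x, C) of S corresponds to the member of {x,x′} on C.

open import Defs
open import Data.Nat using (ℕ; zero; suc; _∸_)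
open import Data.Nat.Properties using (n<1+n; m∸n+n≡m)
open import Data.Nat.GeneralisedArithmetic using (fold; fold-+)
open import Data.Fin using (Fin; toℕ)
open import Data.Fin.Properties using (_≟_; pigeonhole)
open import Data.Fin.Permutation
  using (Permutation′; _⟨$⟩ʳ_; id; flip; _∘ₚ_; inverseˡ; inverseʳ)
open import Data.Product using (∃-syntax; _×_; _,_; proj₁; proj₂)
open import Data.Sum using (_⊎_; inj₁; inj₂) renaming (map to ⊎-map)
open import Data.Empty using (⊥-elim)
open import Function.Bundles using (mk⇔; Equivalence)
open import Function.Construct.Identity using (⇔-id)
open import Function.Construct.Symmetry using (⇔-sym)
open import Function.Construct.Composition using (_⇔-∘_)
open import Level using (Level)
open import Relation.Binary.Core using (Rel)
open import Relation.Binary.Definitions using (Reflexive; Transitive)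
open import Relation.Binary.PropositionalEquality
  using (_≡_; _≢_; refl; sym; trans; cong; subst; subst₂; module ≡-Reasoning)
open import Relation.Binary.Construct.Closure.ReflexiveTransitive
  using (Star; ε; _◅_; _◅◅_) renaming (reverse to Star-reverse)
open import Relation.Nullary using (¬_; yes; no)
open import Relation.Nullary.Decidable using (_×-dec_)

module _ {n : ℕ} where

  infixr 20 _·_
  infixl 25 _^_

  -- The action of a permutation on a point; (g ∘ₚ h) · x = h · g · x.
  _·_ : Permutation′ n → Fin n → Fin n
  g · x = g ⟨$⟩ʳ x

  ·-injective : ∀ g {x y} → g · x ≡ g · y → x ≡ y
  ·-injective g {x} {y} gx≡gy = begin
    x               ≡⟨ sym (inverseˡ g) ⟩
    flip g · g · x  ≡⟨ cong (flip g ·_) gx≡gy ⟩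
    flip g · g · y  ≡⟨ inverseˡ g ⟩
    y               ∎
    where open ≡-Reasoning

  _^_ : Permutation′ n → Permutation′ n → Permutation′ n
  h ^ g = flip g ∘ₚ (h ∘ₚ g)

  ^-· : ∀ h g x → h ^ g · g · x ≡ g · h · x
  ^-· h g x = cong (λ z → g · h · z) (inverseˡ g)

-- Pigeonhole on an orbit: if f never moves a point of the finite set Fin n
-- down in a preorder ⊑, then some point w satisfies f w ⊑ w.  This is how
-- the partner map is shown to be an involution.
module _ {n : ℕ} {ℓ : Level} (_⊑_ : Rel (Fin n) ℓ)
         (⊑-refl : Reflexive _⊑_) (⊑-trans : Transitive _⊑_)
         (f : Fin n → Fin n) (inflationary : ∀ x → x ⊑ f x) where

  ⊑-iterate : ∀ k x → x ⊑ fold x f k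
  ⊑-iterate zero    x = ⊑-refl
  ⊑-iterate (suc k) x = ⊑-trans (⊑-iterate k x) (inflationary (fold x f k))

  returning-point : Fin n → ∃[ w ] f w ⊑ w
  returning-point v with pigeonhole (n<1+n n) (λ k → fold v f (toℕ k))
  ... | i , j , i<j , orbit-repeats = w , subst (f w ⊑_) (sym orbit-repeats) fw⊑vⱼ
    where
    w = fold v f (toℕ i)
    d = toℕ j ∸ suc (toℕ i)

    -- fold v f (d + suc i) is the d-th iterate of f w = fold v f (suc i)
    fw⊑vⱼ : f w ⊑ fold v f (toℕ j)
    fw⊑vⱼ = subst (λ m → f w ⊑ fold v f m) (m∸n+n≡m i<j)
              (subst (f w ⊑_) (sym (fold-+ v f d)) (⊑-iterate d (f w)))

module _ {n : ℕ} (Γ : SimpleGraph n) (G : PermGroup n) where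
  open PermGroup G

  FixedBy : Fin n → Fin n → Set
  FixedBy x y = ∀ h → InStab Γ G x h → h · y ≡ y

  StabBelow : Fin n → Fin n → Set
  StabBelow x y = ∀ h → InStab Γ G x h → InStab Γ G y h

  ^-∈ : ∀ {h g} → InG h → InG g → InG (h ^ g)
  ^-∈ h∈ g∈ = ∘∈ (inv∈ g∈) (∘∈ h∈ g∈)

  stab-^ : ∀ {x h g} → InG g → InStab Γ G x h → InStab Γ G (g · x) (h ^ g)
  stab-^ {x} {h} {g} g∈ (h∈ , hx≡x) = ^-∈ h∈ g∈ , trans (^-· h g x) (cong (g ·_) hx≡x)

  fixedBy-· : ∀ {g x y} → InG g → FixedBy x y → FixedBy (g · x) (g · y)
  fixedBy-· {g} {x} {y} g∈ fix h h∈G_gx = begin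
    h · g · y                    ≡⟨ sym (inverseʳ g) ⟩
    g · (h ^ flip g) · y         ≡⟨ cong (g ·_) (fix (h ^ flip g) h^∈G_x) ⟩
    g · y                        ∎
    where
    open ≡-Reasoning
    h^∈G_x : InStab Γ G x (h ^ flip g)
    h^∈G_x = subst (λ z → InStab Γ G z (h ^ flip g)) (inverseˡ g) (stab-^ (inv∈ g∈) h∈G_gx)

module LocallyZ2 {n : ℕ} (Γ : SimpleGraph n) (G : PermGroup n)
  (aut : SubgroupOfAut Γ G) (vt : VertexTransitive Γ G)
  (v₀ a b c : Fin n) (a≢b : a ≢ b) (a≢c : a ≢ c) (b≢c : b ≢ c)
  (v₀a : SimpleGraph.Adj Γ v₀ a) (v₀b : SimpleGraph.Adj Γ v₀ b) (v₀c : SimpleGraph.Adj Γ v₀ c)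
  (Γv₀ : ∀ w → SimpleGraph.Adj Γ v₀ w → w ≡ a ⊎ w ≡ b ⊎ w ≡ c)
  (stab-fixes-a : FixedBy Γ G v₀ a)
  (t₀ : Permutation′ n) (t₀-stab : InStab Γ G v₀ t₀) (t₀b : t₀ · b ≡ c) (t₀c : t₀ · c ≡ b)
  where

  open SimpleGraph Γ renaming (sym to Adj-sym)
  open PermGroup G
  open ≡-Reasoning

  adj-· : ∀ {g x y} → InG g → Adj x y → Adj (g · x) (g · y)
  adj-· {g} {x} {y} g∈ = Equivalence.to (aut g g∈ x y)

  carry : Fin n → Permutation′ n
  carry u = proj₁ (vt v₀ u)

  carry-∈ : ∀ u → InG (carry u)
  carry-∈ u = proj₁ (proj₂ (vt v₀ u))

  carry-v₀ : ∀ u → carry u · v₀ ≡ u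
  carry-v₀ u = proj₂ (proj₂ (vt v₀ u))

  carry-adj : ∀ u {q} → Adj v₀ q → Adj u (carry u · q)
  carry-adj u {q} v₀q = subst (λ z → Adj z (carry u · q)) (carry-v₀ u) (adj-· (carry-∈ u) v₀q)

  neighbours : ∀ {u w} → Adj u w → w ≡ carry u · a ⊎ w ≡ carry u · b ⊎ w ≡ carry u · c
  neighbours {u} {w} uw = ⊎-map back (⊎-map back back) (Γv₀ (flip g · w) v₀~g⁻¹w)
    where
    g = carry u
    back : ∀ {q} → flip g · w ≡ q → w ≡ g · q
    back g⁻¹w≡q = trans (sym (inverseʳ g)) (cong (g ·_) g⁻¹w≡q)
    g⁻¹u≡v₀ : flip g · u ≡ v₀
    g⁻¹u≡v₀ = trans (cong (flip g ·_) (sym (carry-v₀ u))) (inverseˡ g)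
    v₀~g⁻¹w : Adj v₀ (flip g · w)
    v₀~g⁻¹w = subst (λ z → Adj z (flip g · w)) g⁻¹u≡v₀ (adj-· (inv∈ (carry-∈ u)) uw)

  partner : Fin n → Fin n
  partner u = carry u · a

  partner-fixed : ∀ u → FixedBy Γ G u (partner u)
  partner-fixed u = subst (λ x → FixedBy Γ G x (partner u)) (carry-v₀ u)
                      (fixedBy-· Γ G (carry-∈ u) stab-fixes-a)

  partner-isPartner : ∀ u → Partner Γ G u (partner u)
  partner-isPartner u = carry-adj u v₀a , partner-fixed u

  partner-distinct : ∀ x → x ≢ partner x
  partner-distinct x x≡x′ = irrefl (subst (Adj x) (sym x≡x′) (carry-adj x v₀a))

  swap : Fin n → Permutation′ n
  swap u = t₀ ^ carry u

  swap-stab : ∀ u → InStab Γ G u (swap u)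
  swap-stab u = subst (λ x → InStab Γ G x (swap u)) (carry-v₀ u) (stab-^ Γ G (carry-∈ u) t₀-stab)

  swap-b : ∀ u → swap u · carry u · b ≡ carry u · c
  swap-b u = trans (^-· t₀ (carry u) b) (cong (carry u ·_) t₀b)

  swap-c : ∀ u → swap u · carry u · c ≡ carry u · b
  swap-c u = trans (^-· t₀ (carry u) c) (cong (carry u ·_) t₀c)

  b-not-fixed : ∀ u → ¬ FixedBy Γ G u (carry u · b)
  b-not-fixed u fix = b≢c (·-injective (carry u) (trans (sym (fix (swap u) (swap-stab u))) (swap-b u)))

  c-not-fixed : ∀ u → ¬ FixedBy Γ G u (carry u · c)
  c-not-fixed u fix = b≢c (sym (·-injective (carry u) (trans (sym (fix (swap u) (swap-stab u))) (swap-c u))))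

  partner-unique : ∀ {u w} → Partner Γ G u w → w ≡ partner u
  partner-unique {u} (uw , fix) with neighbours uw
  ... | inj₁ w≡u′        = w≡u′
  ... | inj₂ (inj₁ refl) = ⊥-elim (b-not-fixed u fix)
  ... | inj₂ (inj₂ refl) = ⊥-elim (c-not-fixed u fix)

  partner-· : ∀ {k} → InG k → ∀ x → partner (k · x) ≡ k · partner x
  partner-· k∈ x = sym (partner-unique (adj-· k∈ (carry-adj x v₀a) , fixedBy-· Γ G k∈ (partner-fixed x)))

  -- G_x ⊆ G_{x′}; along the chain x, x′, x″, … the stabilisers grow, so by
  -- pigeonhole some w has G_{w′} ⊆ G_w, making w the partner of w′
  partner-involutive-somewhere : ∃[ w ] partner (partner w) ≡ w
  partner-involutive-somewhere with returning-point (StabBelow Γ G) (λ h s → s)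
                                      (λ x⊆y y⊆z h s → y⊆z h (x⊆y h s)) partner stab-below v₀
    where
    stab-below : ∀ x → StabBelow Γ G x (partner x)
    stab-below x h (h∈ , hx≡x) = h∈ , partner-fixed x h (h∈ , hx≡x)
  ... | w , G_w′⊆G_w = w , sym (partner-unique (Adj-sym (carry-adj w v₀a) , λ h s → proj₂ (G_w′⊆G_w h s)))

  -- by vertex-transitivity and equivariance, ′ is an involution everywhere
  partner-involutive : ∀ u → partner (partner u) ≡ u
  partner-involutive u = transport partner-involutive-somewhere (vt (proj₁ partner-involutive-somewhere) u)
    where
    transport : (p : ∃[ w ] partner (partner w) ≡ w) → ∃[ k ] (InG k × k · proj₁ p ≡ u)
              → partner (partner u) ≡ u
    transport (w , w″≡w) (k , k∈ , kw≡u) = begin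
      partner (partner u)          ≡⟨ cong (λ z → partner (partner z)) (sym kw≡u) ⟩
      partner (partner (k · w))    ≡⟨ cong partner (partner-· k∈ w) ⟩
      partner (k · partner w)      ≡⟨ partner-· k∈ (partner w) ⟩
      k · partner (partner w)      ≡⟨ cong (k ·_) w″≡w ⟩
      k · w                        ≡⟨ kw≡u ⟩
      u                            ∎

  partner-swap : ∀ {x y} → x ≡ partner y → y ≡ partner x
  partner-swap {x} {y} x≡y′ = trans (sym (partner-involutive y)) (cong partner (sym x≡y′))

  R : Fin n → Fin n → Set
  R = InR Γ G

  T-partner : ∀ {x y} → InT Γ G x y → y ≡ partner x
  T-partner (inj₁ xy) = partner-unique xy
  T-partner (inj₂ yx) = partner-swap (partner-unique yx)

  R-intro : ∀ {x y} → Adj x y → y ≢ partner x → R x y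
  R-intro xy y≢x′ = xy , λ t → y≢x′ (T-partner t)

  R-not-partner : ∀ {x y} → R x y → y ≢ partner x
  R-not-partner (_ , not-T) refl = not-T (inj₁ (partner-isPartner _))

  R-sym : ∀ {x y} → R x y → R y x
  R-sym r = R-intro (Adj-sym (proj₁ r)) λ x≡y′ → R-not-partner r (partner-swap x≡y′)

  R-· : ∀ {k x y} → InG k → R x y → R (k · x) (k · y)
  R-· {k} {x} k∈ r = R-intro (adj-· k∈ (proj₁ r)) λ ky≡kx′ →
    R-not-partner r (·-injective k (trans ky≡kx′ (partner-· k∈ x)))

  left right : Fin n → Fin n
  left u = carry u · b
  right u = carry u · c

  R-left : ∀ u → R u (left u)
  R-left u = R-intro (carry-adj u v₀b) λ e → a≢b (sym (·-injective (carry u) e))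

  R-right : ∀ u → R u (right u)
  R-right u = R-intro (carry-adj u v₀c) λ e → a≢c (sym (·-injective (carry u) e))

  R-neighbours : ∀ {u d} → R u d → d ≡ left u ⊎ d ≡ right u
  R-neighbours r with neighbours (proj₁ r)
  ... | inj₁ d≡u′            = ⊥-elim (R-not-partner r d≡u′)
  ... | inj₂ d≡left-or-right = d≡left-or-right

  swap-exchanges : ∀ {u d e} → R u d → R u e → d ≢ e → swap u · d ≡ e
  swap-exchanges {u} rd re d≢e with R-neighbours rd | R-neighbours re
  ... | inj₁ refl | inj₁ refl = ⊥-elim (d≢e refl)
  ... | inj₁ refl | inj₂ refl = swap-b u
  ... | inj₂ refl | inj₁ refl = swap-c u
  ... | inj₂ refl | inj₂ refl = ⊥-elim (d≢e refl)

  -- A rotation at x: an element of G moving the path right x, x, left x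
  -- one step forward along the ℛ-cycle through x.
  Rotation : Fin n → Set
  Rotation x = ∃[ ρ ] (InG ρ × ρ · x ≡ left x × ρ · right x ≡ x)

  -- take k ∈ G with k x = left x; k (right x) is an ℛ-neighbour of left x,
  -- and if it is not x, the swap at left x corrects it
  rotation : ∀ x → Rotation x
  rotation x = from-transporter (vt x y)
    where
    y = left x
    from-transporter : ∃[ k ] (InG k × k · x ≡ y) → Rotation x
    from-transporter (k , k∈ , kx≡y) with k · right x ≟ x
    ... | yes k-fixes = k , k∈ , kx≡y , k-fixes
    ... | no  k-moves =
      k ∘ₚ swap y , ∘∈ k∈ (proj₁ (swap-stab y)) ,
      trans (cong (swap y ·_) kx≡y) (proj₂ (swap-stab y)) ,
      swap-exchanges (subst (λ z → R z (k · right x)) kx≡y (R-· k∈ (R-right x))) (R-sym (R-left x)) k-moves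

  module CycleThrough (x : Fin n) where
    ρ : Permutation′ n
    ρ = proj₁ (rotation x)

    ρ∈ : InG ρ
    ρ∈ = proj₁ (proj₂ (rotation x))

    ρx : ρ · x ≡ left x
    ρx = proj₁ (proj₂ (proj₂ (rotation x)))

    ρ⁻¹x : flip ρ · x ≡ right x
    ρ⁻¹x = trans (cong (flip ρ ·_) (sym (proj₂ (proj₂ (proj₂ (rotation x)))))) (inverseˡ ρ)

    Commutes : Permutation′ n → Set
    Commutes g = ∀ v → g · ρ · v ≡ ρ · g · v

    commutes-∘ : ∀ {g h} → Commutes g → Commutes h → Commutes (g ∘ₚ h)
    commutes-∘ {g} {h} gc hc v = trans (cong (h ·_) (gc v)) (hc (g · v))

    ρ-commutes : Commutes ρ
    ρ-commutes v = refl

    ρ⁻¹-commutes : Commutes (flip ρ)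
    ρ⁻¹-commutes v = trans (inverseˡ ρ) (sym (inverseʳ ρ))

    Reached : Fin n → Set
    Reached d = ∃[ g ] (InG g × Commutes g × g · x ≡ d)

    -- the ℛ-neighbours of x are ρ x and ρ⁻¹ x, so those of g x are g ρ x, g ρ⁻¹ x
    reached-step : ∀ {d e} → Reached d → R d e → Reached e
    reached-step {d} {e} (g , g∈ , gc , gx≡d) r = extend (R-neighbours x~g⁻¹e)
      where
      g⁻¹d≡x : flip g · d ≡ x
      g⁻¹d≡x = trans (cong (flip g ·_) (sym gx≡d)) (inverseˡ g)
      x~g⁻¹e : R x (flip g · e)
      x~g⁻¹e = subst (λ z → R z (flip g · e)) g⁻¹d≡x (R-· (inv∈ g∈) r)
      back : ∀ {q} → q ≡ flip g · e → g · q ≡ e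
      back q≡g⁻¹e = trans (cong (g ·_) q≡g⁻¹e) (inverseʳ g)
      extend : flip g · e ≡ left x ⊎ flip g · e ≡ right x → Reached e
      extend (inj₁ g⁻¹e≡left)  = ρ ∘ₚ g , ∘∈ ρ∈ g∈ , commutes-∘ {ρ} {g} ρ-commutes gc ,
                                 back (trans ρx (sym g⁻¹e≡left))
      extend (inj₂ g⁻¹e≡right) = flip ρ ∘ₚ g , ∘∈ (inv∈ ρ∈) g∈ , commutes-∘ {flip ρ} {g} ρ⁻¹-commutes gc ,
                                 back (trans ρ⁻¹x (sym g⁻¹e≡right))

    reached : ∀ {d} → Star R x d → Reached d
    reached = walk (id , id∈ , (λ v → refl) , refl)
      where
      walk : ∀ {d e} → Reached d → Star R d e → Reached e
      walk here ε          = here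
      walk here (r ◅ path) = walk (reached-step here r) path

  inPair-cases : ∀ {x z} → InPair Γ G x z → z ≡ x ⊎ z ≡ partner x
  inPair-cases (inj₁ z≡x)  = inj₁ z≡x
  inPair-cases (inj₂ x~z) = inj₂ (partner-unique x~z)

  inPair-intro : ∀ {x z} → z ≡ x ⊎ z ≡ partner x → InPair Γ G x z
  inPair-intro (inj₁ z≡x)   = inj₁ z≡x
  inPair-intro (inj₂ refl)  = inj₂ (partner-isPartner _)

  pair-other : ∀ {x a₁ a₂} → InPair Γ G x a₁ → InPair Γ G x a₂ → a₁ ≢ a₂ → a₂ ≡ partner a₁
  pair-other q₁ q₂ a₁≢a₂ with inPair-cases q₁ | inPair-cases q₂
  ... | inj₁ refl | inj₁ refl = ⊥-elim (a₁≢a₂ refl)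
  ... | inj₁ refl | inj₂ refl = refl
  ... | inj₂ refl | inj₁ refl = sym (partner-involutive _)
  ... | inj₂ refl | inj₂ refl = ⊥-elim (a₁≢a₂ refl)

  samePair-partner : ∀ x → SamePair Γ G x (partner x)
  samePair-partner x z = mk⇔ (λ q → inPair-intro (forth (inPair-cases q)))
                             (λ q → inPair-intro (back (inPair-cases q)))
    where
    forth : z ≡ x ⊎ z ≡ partner x → z ≡ partner x ⊎ z ≡ partner (partner x)
    forth (inj₁ z≡x)  = inj₂ (trans z≡x (sym (partner-involutive x)))
    forth (inj₂ z≡x′) = inj₁ z≡x′
    back : z ≡ partner x ⊎ z ≡ partner (partner x) → z ≡ x ⊎ z ≡ partner x
    back (inj₁ z≡x′)  = inj₂ z≡x′
    back (inj₂ z≡x″) = inj₁ (trans z≡x″ (partner-involutive x))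

  samePair-member : ∀ {x z} → InPair Γ G x z → SamePair Γ G x z
  samePair-member q with inPair-cases q
  ... | inj₁ refl = λ t → ⇔-id _
  ... | inj₂ refl = samePair-partner _

  samePair-via : ∀ {x y z w} → InPair Γ G x z → InPair Γ G y w → InPair Γ G z w → SamePair Γ G x y
  samePair-via xz yw zw t =
    ⇔-sym (samePair-member yw t) ⇔-∘ (samePair-member zw t ⇔-∘ samePair-member xz t)

  module _ (nd : ¬ Degenerate Γ G) where

    -- an ℛ-edge {x,y} and an edge {x′,y′} would be two edges between
    -- the pairs {x,x′} and {y,y′}
    no-parallel-edge : ∀ {x y} → R x y → ¬ Adj (partner x) (partner y)
    no-parallel-edge {x} {y} r x′~y′ =
      nd (x , y , x , y , partner x , partner y ,
          inj₁ refl , inj₁ refl , proj₁ r ,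
          inj₂ (partner-isPartner x) , inj₂ (partner-isPartner y) , x′~y′ ,
          (λ { (x≡x′ , _) → partner-distinct x x≡x′ }) ,
          (λ { (_ , y≡x′) → R-not-partner r y≡x′ }))

    edges-between-pairs : ∀ {u v a₁ b₁ a₂ b₂} → Adj a₁ b₁ → Adj a₂ b₂
      → InPair Γ G u a₁ → InPair Γ G v b₁ → InPair Γ G u a₂ → InPair Γ G v b₂
      → (a₁ ≡ a₂ × b₁ ≡ b₂) ⊎ (a₁ ≡ b₂ × b₁ ≡ a₂)
    edges-between-pairs {u} {v} {a₁} {b₁} {a₂} {b₂} e₁ e₂ q₁ q₂ q₃ q₄
      with (a₁ ≟ a₂) ×-dec (b₁ ≟ b₂) | (a₁ ≟ b₂) ×-dec (b₁ ≟ a₂)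
    ... | yes same | _        = inj₁ same
    ... | no  _    | yes reversed = inj₂ reversed
    ... | no  ¬same | no ¬reversed =
      ⊥-elim (nd (u , v , a₁ , b₁ , a₂ , b₂ , q₁ , q₂ , e₁ , q₃ , q₄ , e₂ , ¬same , ¬reversed))

    no-path-to-partner : ∀ x → ¬ Star R x (partner x)
    no-path-to-partner x path with CycleThrough.reached x path
    ... | g , g∈ , gc , gx≡x′ =
      no-parallel-edge (R-left x) (subst₂ Adj gx≡x′ g-left (adj-· g∈ (proj₁ (R-left x))))
      where
      open CycleThrough x
      g-left : g · left x ≡ partner (left x)
      g-left = begin
        g · left x           ≡⟨ cong (g ·_) (sym ρx) ⟩
        g · ρ · x            ≡⟨ gc x ⟩
        ρ · g · x            ≡⟨ cong (ρ ·_) gx≡x′ ⟩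
        ρ · partner x        ≡⟨ sym (partner-· ρ∈ x) ⟩
        partner (ρ · x)      ≡⟨ cong partner ρx ⟩
        partner (left x)     ∎

    Path-sym : ∀ {x y} → Star R x y → Star R y x
    Path-sym = Star-reverse R-sym

    pair-meets-cycle-once : ∀ {r x a₁ a₂} → Star R r a₁ → Star R r a₂
      → InPair Γ G x a₁ → InPair Γ G x a₂ → a₁ ≡ a₂
    pair-meets-cycle-once {a₁ = a₁} {a₂} ra₁ ra₂ q₁ q₂ with a₁ ≟ a₂
    ... | yes a₁≡a₂ = a₁≡a₂
    ... | no  a₁≢a₂ = ⊥-elim (no-path-to-partner a₁
                        (subst (Star R a₁) (pair-other q₁ q₂ a₁≢a₂) (Path-sym ra₁ ◅◅ ra₂)))

    EdgeOf : Fin n → Fin n → Fin n → Set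
    EdgeOf = CycleSet.EdgeOf (𝒞 Γ G)

    SameCycle : Fin n → Fin n → Set
    SameCycle = CycleSet.SameCycle (𝒞 Γ G)

    path⇒sameCycle : ∀ {r s} → Star R r s → SameCycle r s
    path⇒sameCycle rs x y =
      mk⇔ (λ { (a₁ , b₁ , ra₁ , rest) → a₁ , b₁ , Path-sym rs ◅◅ ra₁ , rest })
          (λ { (a₁ , b₁ , sa₁ , rest) → a₁ , b₁ , rs ◅◅ sa₁ , rest })

    -- the edge ι{r, left r} of the cycle of r lies on the cycle of s, and by
    -- non-degeneracy it comes from the same ℛ-edge, which s therefore reaches
    sameCycle⇒path : ∀ {r s} → SameCycle r s → Star R r s
    sameCycle⇒path {r} {s} same
      with Equivalence.to (same r (left r)) (r , left r , ε , R-left r , inj₁ refl , inj₁ refl)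
    ... | c₁ , d₁ , sc₁ , c₁d₁ , q₁ , q₂
      with edges-between-pairs (proj₁ (R-left r)) (proj₁ c₁d₁) (inj₁ refl) (inj₁ refl) q₁ q₂
    ... | inj₁ (r≡c₁ , _)    = Path-sym (subst (Star R s) (sym r≡c₁) sc₁)
    ... | inj₂ (_ , left≡c₁) =
      Path-sym (subst (Star R s) (sym left≡c₁) sc₁ ◅◅ (R-sym (R-left r) ◅ ε))

    Γ′ : Graph
    Γ′ = S (M Γ G) (𝒞 Γ G)

    open Graph Γ′ using () renaming (V to V′; _≈_ to _≈′_; _~_ to _~′_)

    member : V′ → Fin n
    member (_ , _ , a₁ , _) = a₁

    vertex : Fin n → V′
    vertex u = (u , u) , left u , u , left u , ε , R-left u , inj₁ refl , inj₁ refl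

    member-cong : ∀ P Q → P ≈′ Q → member P ≡ member Q
    member-cong (_ , _ , a₁ , _ , ra₁ , _ , qa₁ , _) (_ , _ , a₂ , _ , ra₂ , _ , qa₂ , _) (same-pair , same-cycle) =
      pair-meets-cycle-once ra₁ (sameCycle⇒path same-cycle ◅◅ ra₂) qa₁ (Equivalence.from (same-pair a₂) qa₂)

    vertex-cong : ∀ {u w} → u ≡ w → vertex u ≈′ vertex w
    vertex-cong refl = (λ z → ⇔-id _) , (λ x y → ⇔-id _)

    vertex-member : ∀ P → vertex (member P) ≈′ P
    vertex-member (_ , _ , a₁ , _ , ra₁ , _ , qa₁ , _) =
      samePair-via (inj₁ refl) qa₁ (inj₁ refl) , path⇒sameCycle (Path-sym ra₁)

    member-adj : ∀ P Q → P ~′ Q → Adj (member P) (member Q)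
    member-adj ((x , r) , _ , a₁ , _ , ra₁ , _ , qa₁ , _) ((y , s) , _ , b₁ , _ , sb₁ , _ , qb₁ , _)
               (inj₁ (other-cycle , same-pair)) with a₁ ≟ b₁
    ... | yes a₁≡b₁ = ⊥-elim (other-cycle (path⇒sameCycle (subst (Star R r) a₁≡b₁ ra₁ ◅◅ Path-sym sb₁)))
    ... | no  a₁≢b₁ = subst (Adj a₁) (sym (pair-other qa₁ (Equivalence.from (same-pair b₁) qb₁) a₁≢b₁))
                            (carry-adj a₁ v₀a)
    member-adj ((x , r) , _ , a₁ , _ , ra₁ , _ , qa₁ , _) ((y , s) , _ , b₁ , _ , sb₁ , _ , qb₁ , _)
               (inj₂ (same-cycle , c₁ , d₁ , rc₁ , c₁d₁ , qc₁ , qd₁)) =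
      subst₂ Adj (pair-meets-cycle-once rc₁ ra₁ qc₁ qa₁)
                 (pair-meets-cycle-once (rc₁ ◅◅ (c₁d₁ ◅ ε)) (sameCycle⇒path same-cycle ◅◅ sb₁) qd₁ qb₁)
                 (proj₁ c₁d₁)

    adj-member : ∀ P Q → Adj (member P) (member Q) → P ~′ Q
    adj-member ((x , r) , _ , a₁ , _ , ra₁ , _ , qa₁ , _) ((y , s) , _ , b₁ , _ , sb₁ , _ , qb₁ , _) a₁b₁
      with b₁ ≟ partner a₁
    ... | yes b₁≡a₁′ = inj₁ (other-cycle , samePair-via qa₁ qb₁ (inPair-intro (inj₂ b₁≡a₁′)))
      where
      other-cycle : ¬ SameCycle r s
      other-cycle same = no-path-to-partner a₁
        (subst (Star R a₁) b₁≡a₁′ (Path-sym ra₁ ◅◅ sameCycle⇒path same ◅◅ sb₁))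
    ... | no  b₁≢a₁′ = inj₂ (path⇒sameCycle (ra₁ ◅◅ (a₁b₁′ ◅ Path-sym sb₁)) , a₁ , b₁ , ra₁ , a₁b₁′ , qa₁ , qb₁)
      where
      a₁b₁′ : R a₁ b₁
      a₁b₁′ = R-intro a₁b₁ b₁≢a₁′

    isomorphism : Γ′ ≅ asGraph Γ
    isomorphism = record
      { to        = member
      ; from      = vertex
      ; to-cong   = λ {P} {Q} → member-cong P Q
      ; from-cong = vertex-cong
      ; to-from   = λ u → refl
      ; from-to   = vertex-member
      ; adj       = λ P Q → mk⇔ (member-adj P Q) (adj-member P Q)
      }

theorem4p8 : (n : ℕ) (Γ : SimpleGraph n) (G : PermGroup n)
    → Cubic Γ → Connected Γ
    → SubgroupOfAut Γ G → VertexTransitive Γ G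
    → LocallyZ2-3 Γ G → ¬ Degenerate Γ G
    → S (M Γ G) (𝒞 Γ G) ≅ asGraph Γ
theorem4p8 n Γ G _ _ aut vt
  (v₀ , a , b , c , (a≢b , a≢c , b≢c) , (v₀a , v₀b , v₀c) , Γv₀ , G_v₀-action , (t₀ , t₀-stab , t₀b , t₀c)) nd =
  LocallyZ2.isomorphism Γ G aut vt v₀ a b c a≢b a≢c b≢c v₀a v₀b v₀c Γv₀
    (λ g g∈G_v₀ → proj₁ (G_v₀-action g g∈G_v₀)) t₀ t₀-stab t₀b t₀c nd
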